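{- Let $X$ be a shift space and $m\ge1$. The following are equivalent: (i) $X$ is eventually dendric with threshold $m$; (ii) the graph $\mathcal E_n(w)$ is a tree for every $n\ge1$ and every $w\in\mathcal L_{\ge m}(X)$; (iii) there is an integer $n\ge1$ such that $\mathcal E_n(w)$ is a tree for every $w\in\mathcal L_{\ge m}(X)$.
   Context: A shift space on a finite alphabet $A$ is a closed shift-invariant subset of $A^{\mathbb Z}$; $\mathcal L(X)$ is its set of finite factors, $\mathcal L_n(X)$ those of length $n$, $\mathcal L_{\ge m}(X)$ those of length at least $m$. For $w\in\mathcal L(X)$ and $n\ge1$: $L_n(w)=\{u\in\mathcal L_n(X):uw\in\mathcal L(X)\}$, $R_n(w)=\{v\in\mathcal L_n(X):wv\in\mathcal L(X)\}$; the extension graph $\mathcal E_n(w)$ is the undirected bipartite graph with vertex set the disjoint union of $L_n(w)$ and $R_n(w)$ and edges the pairs $(u,v)$ with $uwv\in\mathcal L(X)$. $X$ is eventually dendric with threshold $m$ if $\mathcal E_1(w)$ is a tree for every $w\in\mathcal L_{\ge m}(X)$. -}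

module Defs where

open import Data.Nat using (ℕ; zero; suc; _≤_)
open import Data.Integer using (ℤ; ∣_∣; _+_; +_)
open import Data.Fin using (Fin)
open import Data.List using (List; []; _∷_; _++_; length; take)
open import Data.List.Relation.Unary.Linked using (Linked)
open import Data.List.Relation.Unary.Unique.Propositional using (Unique)
open import Data.Product using (Σ; _×_; ∃-syntax)
open import Data.Sum using (_⊎_; inj₁; inj₂)
open import Data.Unit using (⊤)
open import Data.Empty using (⊥)
open import Relation.Binary.PropositionalEquality using (_≡_)

Config : ℕ → Set
Config k = ℤ → Fin k

Word : ℕ → Set
Word k = List (Fin k)

σ : ∀ {k} → Config k → Config k
σ x i = x (i + + 1)

-- A shift space: a closed (product topology) shift-invariant (σ(X) = X) subset of A^ℤ.
record Shift (k : ℕ) : Set₁ where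
  field
    Pt        : Config k → Set
    shift-fwd : ∀ x → Pt x → Pt (σ x)
    shift-bwd : ∀ x → Pt (σ x) → Pt x
    closed    : ∀ x → (∀ (N : ℕ) → Σ (Config k) λ y → Pt y × (∀ (i : ℤ) → ∣ i ∣ ≤ N → y i ≡ x i)) → Pt x
open Shift public

OccursAt : ∀ {k} → Config k → ℤ → Word k → Set
OccursAt x i []      = ⊤
OccursAt x i (a ∷ w) = (x i ≡ a) × OccursAt x (i + + 1) w

InL : ∀ {k} → Shift k → Word k → Set
InL {k} X w = Σ (Config k) λ x → Pt X x × Σ ℤ λ i → OccursAt x i w

record Graph : Set₁ where
  field
    V   : Set
    IsV : V → Set
    Adj : V → V → Set
open Graph public

data Walk (G : Graph) : V G → V G → Set where
  here : ∀ {a} → Walk G a a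
  step : ∀ {a b c} → Adj G a b → Walk G b c → Walk G a c

Connected : Graph → Set
Connected G = ∀ a b → IsV G a → IsV G b → Walk G a b

-- a cycle: at least 3 distinct vertices v0..v_{r-1}, consecutive ones adjacent, v_{r-1} adjacent to v0
Cycle : Graph → Set
Cycle G = Σ (List (V G)) λ vs → (3 ≤ length vs) × Unique vs × Linked (Adj G) (vs ++ take 1 vs)

Acyclic : Graph → Set
Acyclic G = Cycle G → ⊥

IsTree : Graph → Set
IsTree G = Connected G × Acyclic G

-- The extension graph E_n(w): vertices inj₁ u for u ∈ L_n(w), inj₂ v for v ∈ R_n(w)
-- (disjoint union), edges {u,v} with u w v ∈ L(X).
ExtV : ∀ {k} → Shift k → ℕ → Word k → Word k ⊎ Word k → Set
ExtV X n w (inj₁ u) = (length u ≡ n) × InL X (u ++ w)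
ExtV X n w (inj₂ v) = (length v ≡ n) × InL X (w ++ v)

ExtAdj : ∀ {k} → Shift k → ℕ → Word k → Word k ⊎ Word k → Word k ⊎ Word k → Set
ExtAdj X n w (inj₁ u) (inj₂ v) = (length u ≡ n) × (length v ≡ n) × InL X (u ++ w ++ v)
ExtAdj X n w (inj₂ v) (inj₁ u) = (length u ≡ n) × (length v ≡ n) × InL X (u ++ w ++ v)
ExtAdj X n w (inj₁ _) (inj₁ _) = ⊥
ExtAdj X n w (inj₂ _) (inj₂ _) = ⊥

E : ∀ {k} → Shift k → ℕ → Word k → Graph
E {k} X n w = record { V = Word k ⊎ Word k ; IsV = ExtV X n w ; Adj = ExtAdj X n w }

EventuallyDendric : ∀ {k} → Shift k → ℕ → Set
EventuallyDendric {k} X m = ∀ (w : Word k) → m ≤ length w → InL X w → IsTree (E X 1 w)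

module Submission where

-- Let ext p q w be the extension graph of w with left words of length p and right words of
-- length q, so that Eₙ(w) = ext n n w.  Then ext p (q+1) w fibres over ext p q w: the right word
-- c b (b a letter) lies over c, and the fibre over c is ext p 1 (w c); symmetrically ext (p+1) q w
-- fibres over ext p q w with fibres ext 1 q (c w).  For any fibration H → B of bipartite graphs,
--   (a) if B and all fibres are trees, so is H: walks of B lift, and a cycle of H either lies in
--       one fibre or, once its runs inside fibres are merged, projects to a cycle of B;
--   (b) if H is a tree and all fibres are connected, B is a tree: B is connected as the projection
--       is onto, and a cycle of B lifts to a non-backtracking closed walk of H, which contains a cycle.
-- The fibres sit over longer words, so (a) builds every ext p q w from the ext 1 1, while (b)
-- brings ext n n back down to ext 1 1, connectivity descending first.

open import Defs
open import Data.Nat using (ℕ; zero; suc; _≤_; _+_; _∸_; s≤s; z≤n)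
import Data.Nat.Properties as ℕP
open import Data.Integer as ℤ using (ℤ; +_; -[1+_])
import Data.Integer.Properties as ℤP
import Data.Fin.Properties as FinP
open import Data.List using (List; []; _∷_; _++_; length; take; drop; map; derun)
import Data.List.Properties as LP
open import Data.List.Relation.Unary.Linked as Linked using (Linked; []; [-]; _∷_)
import Data.List.Relation.Unary.Linked.Properties as LinkedP
open import Data.List.Relation.Unary.Unique.Propositional using (Unique)
import Data.List.Relation.Unary.Unique.Propositional.Properties as UniqueP
open import Data.List.Relation.Unary.All as All using (All; []; _∷_)
import Data.List.Relation.Unary.All.Properties as AllP
open import Data.List.Relation.Unary.AllPairs as AllPairs using (AllPairs; []; _∷_)
import Data.List.Relation.Unary.AllPairs.Properties as AllPairsP
open import Data.List.Relation.Unary.Any using (here; there)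
open import Data.List.Membership.Propositional using (_∈_)
import Data.List.Membership.DecPropositional as DecMembership
open import Data.Product using (Σ; _×_; _,_; proj₁; proj₂)
open import Data.Sum using (_⊎_; inj₁; inj₂; [_,_])
import Data.Sum.Properties as ⊎P
open import Data.Unit using (⊤; tt)
open import Data.Empty using (⊥; ⊥-elim)
open import Function.Bundles using (_⇔_; mk⇔)
open import Relation.Nullary using (yes; no)
open import Relation.Binary.Definitions using (DecidableEquality)
open import Relation.Binary.PropositionalEquality hiding ([_])

module _ {k : ℕ} where

  occurs-prefix : ∀ (x : Config k) i xs ys → OccursAt x i (xs ++ ys) → OccursAt x i xs
  occurs-prefix x i []       ys o       = tt
  occurs-prefix x i (a ∷ xs) ys (p , o) = p , occurs-prefix x (i ℤ.+ + 1) xs ys o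

  occurs-suffix : ∀ (x : Config k) i xs ys → OccursAt x i (xs ++ ys) → OccursAt x (i ℤ.+ + length xs) ys
  occurs-suffix x i []       ys o       = subst (λ j → OccursAt x j ys) (sym (ℤP.+-identityʳ i)) o
  occurs-suffix x i (a ∷ xs) ys (p , o) =
    subst (λ j → OccursAt x j ys) (ℤP.+-assoc i (+ 1) (+ length xs)) (occurs-suffix x (i ℤ.+ + 1) xs ys o)

  occurs-++ : ∀ (x : Config k) i xs ys → OccursAt x i xs → OccursAt x (i ℤ.+ + length xs) ys → OccursAt x i (xs ++ ys)
  occurs-++ x i []       ys _       o' = subst (λ j → OccursAt x j ys) (ℤP.+-identityʳ i) o'
  occurs-++ x i (a ∷ xs) ys (p , o) o' =
    p , occurs-++ x (i ℤ.+ + 1) xs ys o (subst (λ j → OccursAt x j ys) (sym (ℤP.+-assoc i (+ 1) (+ length xs))) o')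

  window : Config k → ℤ → ℕ → Word k
  window x i zero    = []
  window x i (suc n) = x i ∷ window x (i ℤ.+ + 1) n

  window-occurs : ∀ x i n → OccursAt x i (window x i n)
  window-occurs x i zero    = tt
  window-occurs x i (suc n) = refl , window-occurs x (i ℤ.+ + 1) n

  window-length : ∀ x i n → length (window x i n) ≡ n
  window-length x i zero    = refl
  window-length x i (suc n) = cong suc (window-length x (i ℤ.+ + 1) n)

  module _ (X : Shift k) where

    InL-prefix : ∀ xs ys → InL X (xs ++ ys) → InL X xs
    InL-prefix xs ys (x , x∈X , i , o) = x , x∈X , i , occurs-prefix x i xs ys o

    InL-suffix : ∀ xs ys → InL X (xs ++ ys) → InL X ys
    InL-suffix xs ys (x , x∈X , i , o) = x , x∈X , _ , occurs-suffix x i xs ys o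

    InL-assoc : ∀ xs ys zs → InL X ((xs ++ ys) ++ zs) → InL X (xs ++ ys ++ zs)
    InL-assoc xs ys zs = subst (InL X) (LP.++-assoc xs ys zs)

    InL-unassoc : ∀ xs ys zs → InL X (xs ++ ys ++ zs) → InL X ((xs ++ ys) ++ zs)
    InL-unassoc xs ys zs = subst (InL X) (sym (LP.++-assoc xs ys zs))

    InL-extendʳ : ∀ w → InL X w → (n : ℕ) → Σ (Word k) λ v → length v ≡ n × InL X (w ++ v)
    InL-extendʳ w (x , x∈X , i , o) n =
      window x (i ℤ.+ + length w) n , window-length x _ n ,
      x , x∈X , i , occurs-++ x i w _ o (window-occurs x _ n)

    InL-extendˡ : ∀ w → InL X w → (n : ℕ) → Σ (Word k) λ u → length u ≡ n × InL X (u ++ w)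
    InL-extendˡ w w∈L zero    = [] , refl , w∈L
    InL-extendˡ w w∈L (suc n) with InL-extendˡ w w∈L n
    ... | u , ∣u∣≡n , (x , x∈X , j , o) =
      x (j ℤ.+ -[1+ 0 ]) ∷ u , cong suc ∣u∣≡n , x , x∈X , j ℤ.+ -[1+ 0 ] , refl ,
      subst (λ t → OccursAt x t (u ++ w)) (sym back-and-forth) o
      where
      back-and-forth : (j ℤ.+ -[1+ 0 ]) ℤ.+ + 1 ≡ j
      back-and-forth = trans (ℤP.+-assoc j -[1+ 0 ] (+ 1)) (ℤP.+-identityʳ j)

rotate-unique : ∀ {A : Set} {a : A} {as} → Unique (a ∷ as) → Unique (as ++ a ∷ [])
rotate-unique {as = []}     _                              = [] ∷ []
rotate-unique {as = b ∷ as} ((a≢b ∷ a∉) ∷ (b∉ ∷ distinct)) =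
  AllP.++⁺ b∉ ((λ eq → a≢b (sym eq)) ∷ []) ∷ rotate-unique (a∉ ∷ distinct)

snoc-linked : ∀ {A : Set} {R : A → A → Set} {a b} (as : List A) → Linked R (as ++ a ∷ []) → R a b →
              Linked R ((as ++ a ∷ []) ++ b ∷ [])
snoc-linked []           _        r = r ∷ [-]
snoc-linked (_ ∷ [])     (r' ∷ l) r = r' ∷ snoc-linked [] l r
snoc-linked (_ ∷ _ ∷ as) (r' ∷ l) r = r' ∷ snoc-linked (_ ∷ as) l r

record Hom (G G' : Graph) : Set where
  field
    vmap : V G → V G'
    amap : ∀ {a b} → Adj G a b → Adj G' (vmap a) (vmap b)
open Hom public

mapWalk : ∀ {G G'} (h : Hom G G') {a b} → Walk G a b → Walk G' (vmap h a) (vmap h b)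
mapWalk h here       = here
mapWalk h (step e w) = step (amap h e) (mapWalk h w)

Onto : ∀ {G G'} → Hom G G' → Set
Onto {G} {G'} h = ∀ b → IsV G' b → Σ (V G) λ a → IsV G a × vmap h a ≡ b

connected-onto : ∀ {G G'} (h : Hom G G') → Onto h → Connected G → Connected G'
connected-onto h onto conn b b' vb vb' with onto b vb | onto b' vb'
... | a , va , refl | a' , va' , refl = mapWalk h (conn a a' va va')

acyclic-injective : ∀ {G G'} (h : Hom G G') → (∀ {a b} → vmap h a ≡ vmap h b → a ≡ b) → Acyclic G' → Acyclic G
acyclic-injective h inj acyclic (vs , 3≤ , distinct , linked) =
  acyclic (map (vmap h) vs ,
           subst (3 ≤_) (sym (LP.length-map (vmap h) vs)) 3≤ ,
           UniqueP.map⁺ inj distinct ,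
           subst (Linked _) closed-map (LinkedP.map⁺ (Linked.map (amap h) linked)))
  where
  closed-map : map (vmap h) (vs ++ take 1 vs) ≡ map (vmap h) vs ++ take 1 (map (vmap h) vs)
  closed-map = trans (LP.map-++ (vmap h) vs (take 1 vs)) (cong (map (vmap h) vs ++_) (sym (LP.take-map 1 vs)))

record _≅_ (G G' : Graph) : Set where
  field
    to        : Hom G G'
    from      : Hom G' G
    from∘to   : ∀ a → vmap from (vmap to a) ≡ a
    to∘from   : ∀ b → vmap to (vmap from b) ≡ b
    to-IsV    : ∀ {a} → IsV G a → IsV G' (vmap to a)
    from-IsV  : ∀ {b} → IsV G' b → IsV G (vmap from b)

module _ {G G' : Graph} (iso : G ≅ G') where
  open _≅_ iso

  ≅-connected : Connected G → Connected G'
  ≅-connected = connected-onto to (λ b vb → vmap from b , from-IsV vb , to∘from b)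

  ≅-tree : IsTree G → IsTree G'
  ≅-tree (conn , acyclic) =
    ≅-connected conn ,
    acyclic-injective from (λ {b} {b'} eq → trans (sym (to∘from b)) (trans (cong (vmap to) eq) (to∘from b'))) acyclic

≅-sym : ∀ {G G'} → G ≅ G' → G' ≅ G
≅-sym iso = record { to = from ; from = to ; from∘to = to∘from ; to∘from = from∘to ; to-IsV = from-IsV ; from-IsV = to-IsV }
  where open _≅_ iso

module _ {G : Graph} where

  _++ʷ_ : ∀ {a b c} → Walk G a b → Walk G b c → Walk G a c
  here     ++ʷ q = q
  step e p ++ʷ q = step e (p ++ʷ q)

  NonEmpty : ∀ {a b} → Walk G a b → Set
  NonEmpty here       = ⊥
  NonEmpty (step _ _) = ⊤

  second : ∀ {a b} → Walk G a b → V G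
  second {a} here           = a
  second (step {b = b} _ _) = b

  penultimate : ∀ {a b} → Walk G a b → V G
  penultimate {a} here            = a
  penultimate {a} (step _ here)   = a
  penultimate (step _ (step e w)) = penultimate (step e w)

  NonBacktracking : ∀ {a b} → Walk G a b → Set
  NonBacktracking here                            = ⊤
  NonBacktracking (step _ here)                   = ⊤
  NonBacktracking (step {a} _ (step {b = c} e w)) = a ≢ c × NonBacktracking (step e w)

  NonBacktracking-tail : ∀ {a b c} (e : Adj G a b) (w : Walk G b c) → NonBacktracking (step e w) → NonBacktracking w
  NonBacktracking-tail e here         _        = tt
  NonBacktracking-tail e (step e' w) (_ , nb) = nb

  nonEmpty-distinct : ∀ {a b} (w : Walk G a b) → a ≢ b → NonEmpty w
  nonEmpty-distinct here       a≢a = a≢a refl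
  nonEmpty-distinct (step _ _) _   = tt

  second-adj : ∀ {a b} (w : Walk G a b) → NonEmpty w → Adj G a (second w)
  second-adj (step e w) _ = e

  penultimate-adj : ∀ {a b} (w : Walk G a b) → NonEmpty w → Adj G (penultimate w) b
  penultimate-adj (step e here)        _ = e
  penultimate-adj (step _ (step e w)) _ = penultimate-adj (step e w) tt

  ++ʷ-nonBacktracking : ∀ {a b c} (p : Walk G a b) (q : Walk G b c) → NonBacktracking p → NonBacktracking q →
                        (NonEmpty p → NonEmpty q → penultimate p ≢ second q) → NonBacktracking (p ++ʷ q)
  ++ʷ-nonBacktracking here                 q          _          nbq _    = nbq
  ++ʷ-nonBacktracking (step e here)        here       _          _   _    = tt
  ++ʷ-nonBacktracking (step e here)        (step _ q) _          nbq turn = turn tt tt , nbq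
  ++ʷ-nonBacktracking (step e (step e' p)) q          (ne , nbp) nbq turn =
    ne , ++ʷ-nonBacktracking (step e' p) q nbp nbq turn

  ++ʷ-nonEmpty : ∀ {a b c} (p : Walk G a b) (q : Walk G b c) → NonEmpty p → NonEmpty (p ++ʷ q)
  ++ʷ-nonEmpty (step e p) q _ = tt

  ++ʷ-second : ∀ {a b c} (p : Walk G a b) (q : Walk G b c) → NonEmpty p → second (p ++ʷ q) ≡ second p
  ++ʷ-second (step e p) q _ = refl

module _ {G G' : Graph} (h : Hom G G') where

  mapWalk-nonEmpty : ∀ {a b} (w : Walk G a b) → NonEmpty w → NonEmpty (mapWalk h w)
  mapWalk-nonEmpty (step e w) _ = tt

  mapWalk-second : ∀ {a b} (w : Walk G a b) → second (mapWalk h w) ≡ vmap h (second w)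
  mapWalk-second here       = refl
  mapWalk-second (step e w) = refl

  mapWalk-penultimate : ∀ {a b} (w : Walk G a b) → penultimate (mapWalk h w) ≡ vmap h (penultimate w)
  mapWalk-penultimate here                = refl
  mapWalk-penultimate (step e here)       = refl
  mapWalk-penultimate (step _ (step e w)) = mapWalk-penultimate (step e w)

  mapWalk-nonBacktracking : (∀ {a b} → vmap h a ≡ vmap h b → a ≡ b) →
                            ∀ {a b} (w : Walk G a b) → NonBacktracking w → NonBacktracking (mapWalk h w)
  mapWalk-nonBacktracking inj here                _          = tt
  mapWalk-nonBacktracking inj (step e here)       _          = tt
  mapWalk-nonBacktracking inj (step e (step e' w)) (ne , nb) =
    (λ eq → ne (inj eq)) , mapWalk-nonBacktracking inj (step e' w) nb

module SimpleGraph (G : Graph) (_≟_ : DecidableEquality (V G))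
                   (adj-sym : ∀ {a b} → Adj G a b → Adj G b a) (adj-irrefl : ∀ {a} → Adj G a a → ⊥) where

  cons-reduced : ∀ {a b c} → Adj G a b → (w : Walk G b c) → NonBacktracking w → Σ (Walk G a c) NonBacktracking
  cons-reduced e here nb = step e here , tt
  cons-reduced {a} e (step {b = x} e' w) nb with x ≟ a
  ... | yes refl = w , NonBacktracking-tail e' w nb
  ... | no x≢a   = step e (step e' w) , (λ eq → x≢a (sym eq)) , nb

  reduce : ∀ {a b} → Walk G a b → Σ (Walk G a b) NonBacktracking
  reduce here       = here , tt
  reduce (step e w) = cons-reduced e (proj₁ (reduce w)) (proj₂ (reduce w))

  open DecMembership _≟_ using (_∈?_)

  upTo : ∀ {x : V G} {xs} → x ∈ xs → List (V G)
  upTo (here {x} _)  = x ∷ []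
  upTo (there {y} i) = y ∷ upTo i

  upTo-All : ∀ {P : V G → Set} {x xs} (i : x ∈ xs) → All P xs → All P (upTo i)
  upTo-All (here refl) (p ∷ _)  = p ∷ []
  upTo-All (there i)   (p ∷ ps) = p ∷ upTo-All i ps

  upTo-unique : ∀ {x xs} (i : x ∈ xs) → Unique xs → Unique (upTo i)
  upTo-unique (here refl) (_ ∷ _)  = [] ∷ []
  upTo-unique (there i)   (d ∷ ds) = upTo-All i d ∷ upTo-unique i ds

  upTo-linked : ∀ {x y z xs} → Linked (Adj G) (y ∷ xs) → (i : x ∈ xs) → Adj G x z → Linked (Adj G) (y ∷ upTo i ++ z ∷ [])
  upTo-linked (e ∷ _)  (here refl) e' = e ∷ e' ∷ [-]
  upTo-linked (e ∷ es) (there i)   e' = e ∷ upTo-linked es i e'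

  upTo-nonEmpty : ∀ {x xs} (i : x ∈ xs) → 1 ≤ length (upTo i)
  upTo-nonEmpty (here _)  = s≤s z≤n
  upTo-nonEmpty (there _) = s≤s z≤n

  LeavesFresh : ∀ {h a} → List (V G) → Walk G h a → Set
  LeavesFresh []      _                  = ⊤
  LeavesFresh (_ ∷ _) here               = ⊤
  LeavesFresh (p ∷ _) (step {b = x} _ _) = x ≢ p

  leavesFresh : ∀ {h x c seen} (e : Adj G h x) (w : Walk G x c) → NonBacktracking (step e w) →
                LeavesFresh (h ∷ seen) w
  leavesFresh e here        _        = tt
  leavesFresh e (step _ w) (ne , _) = λ eq → ne (sym eq)

  -- Follow the walk from h, with the visited vertices `seen` (most recent first), pairwise
  -- distinct and forming a path back from h.  The walk ends in a visited vertex, so some vertex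
  -- repeats; the first repetition is neither h (no loops) nor its predecessor (no backtracking),
  -- so it closes a cycle of length at least 3.
  scan : ∀ {a} (h : V G) (seen : List (V G)) → Unique (h ∷ seen) → Linked (Adj G) (h ∷ seen) → a ∈ seen →
         (w : Walk G h a) → NonBacktracking w → LeavesFresh seen w → Cycle G
  scan h seen (h∉ ∷ _) _ h∈ here _ _ = ⊥-elim (AllP.All¬⇒¬Any h∉ h∈)
  scan h seen distinct path a∈ (step {b = x} e w) nb fresh with x ∈? (h ∷ seen)
  scan h seen       _                _    _  (step e w) _ _     | yes (here refl)         = ⊥-elim (adj-irrefl e)
  scan h (p ∷ seen) _                _    _  (step e w) _ fresh | yes (there (here refl)) = ⊥-elim (fresh refl)
  scan h (p ∷ seen) (h∉ ∷ distinct) path _  (step e w) _ _     | yes (there (there i))   =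
    h ∷ upTo (there i) , s≤s (s≤s (upTo-nonEmpty i)) ,
    upTo-All (there i) h∉ ∷ upTo-unique (there i) distinct , upTo-linked path (there i) (adj-sym e)
  scan h seen distinct path a∈ (step e w) nb fresh | no x∉ =
    scan _ (h ∷ seen) (AllP.¬Any⇒All¬ _ x∉ ∷ distinct) (adj-sym e ∷ path) (there a∈) w
         (NonBacktracking-tail e w nb) (leavesFresh e w nb)

  circuit⇒cycle : ∀ {a b} (w : Walk G a b) → a ≡ b → NonEmpty w → NonBacktracking w → Cycle G
  circuit⇒cycle {a} (step {b = x} e w) refl _ nb with x ≟ a
  ... | yes refl = ⊥-elim (adj-irrefl e)
  ... | no x≢a   = scan x (a ∷ []) ((x≢a ∷ []) ∷ [] ∷ []) (adj-sym e ∷ [-]) (here refl) w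
                        (NonBacktracking-tail e w nb) (leavesFresh e w nb)

record Bipartite (W : Set) : Set₁ where
  field
    Left Right : W → Set
    Edge       : W → W → Set
    edge-left  : ∀ {x y} → Edge x y → Left x
    edge-right : ∀ {x y} → Edge x y → Right y
open Bipartite public

module _ {W : Set} where

  BiAdj : Bipartite W → W ⊎ W → W ⊎ W → Set
  BiAdj B (inj₁ x) (inj₂ y) = Edge B x y
  BiAdj B (inj₂ y) (inj₁ x) = Edge B x y
  BiAdj B (inj₁ _) (inj₁ _) = ⊥
  BiAdj B (inj₂ _) (inj₂ _) = ⊥

  graph : Bipartite W → Graph
  graph B = record { V = W ⊎ W ; IsV = [ Left B , Right B ] ; Adj = BiAdj B }

  biAdj-sym : ∀ (B : Bipartite W) {a b} → BiAdj B a b → BiAdj B b a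
  biAdj-sym B {inj₁ _} {inj₂ _} e = e
  biAdj-sym B {inj₂ _} {inj₁ _} e = e

  biAdj-irrefl : ∀ (B : Bipartite W) {a} → BiAdj B a a → ⊥
  biAdj-irrefl B {inj₁ _} ()
  biAdj-irrefl B {inj₂ _} ()

  swap : Bipartite W → Bipartite W
  swap B = record { Left = Right B ; Right = Left B ; Edge = λ x y → Edge B y x
                  ; edge-left = edge-right B ; edge-right = edge-left B }

  swap-≅ : (B : Bipartite W) → graph B ≅ graph (swap B)
  swap-≅ B = record { to = exchange B ; from = exchange (swap B)
                    ; from∘to = exchange-involutive ; to∘from = exchange-involutive
                    ; to-IsV = λ {a} → on-IsV B a ; from-IsV = λ {a} → on-IsV (swap B) a }
    where
    flip⊎ : W ⊎ W → W ⊎ W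
    flip⊎ = [ inj₂ , inj₁ ]
    exchange-involutive : ∀ a → flip⊎ (flip⊎ a) ≡ a
    exchange-involutive (inj₁ _) = refl
    exchange-involutive (inj₂ _) = refl
    exchange : (C : Bipartite W) → Hom (graph C) (graph (swap C))
    exchange C = record { vmap = flip⊎ ; amap = λ {a} {b} → flip-adj a b }
      where
      flip-adj : ∀ a b → BiAdj C a b → BiAdj (swap C) (flip⊎ a) (flip⊎ b)
      flip-adj (inj₁ _) (inj₂ _) e = e
      flip-adj (inj₂ _) (inj₁ _) e = e
    on-IsV : (C : Bipartite W) → ∀ a → IsV (graph C) a → IsV (graph (swap C)) (flip⊎ a)
    on-IsV C (inj₁ _) v = v
    on-IsV C (inj₂ _) v = v

module BipartiteWalks {W : Set} (_≟_ : DecidableEquality W) (B : Bipartite W) =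
  SimpleGraph (graph B) (⊎P.≡-dec _≟_ _≟_) (λ {a} {b} → biAdj-sym B {a} {b}) (λ {a} → biAdj-irrefl B {a})

-- Walks in a bipartite graph that start on the left are zigzags x₀ y₁ x₁ y₂ x₂ … y_r x_r, which we
-- record as x₀ together with the list of steps (y_i , x_i).  Every cycle is a closed zigzag.
module Zigzags {W : Set} (_≟_ : DecidableEquality W) (B : Bipartite W) where

  open BipartiteWalks _≟_ B using (circuit⇒cycle)

  Zigzag : W → List (W × W) → Set
  Zigzag x₀ []             = ⊤
  Zigzag x₀ ((y , x) ∷ ps) = Edge B x₀ y × Edge B x y × Zigzag x ps

  endpoint : W → List (W × W) → W
  endpoint x₀ []             = x₀
  endpoint x₀ ((y , x) ∷ ps) = endpoint x ps

  zigzag-walk : ∀ x₀ ps → Zigzag x₀ ps → Walk (graph B) (inj₁ x₀) (inj₁ (endpoint x₀ ps))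
  zigzag-walk x₀ []             _           = here
  zigzag-walk x₀ ((y , x) ∷ ps) (e , e' , z) = step {b = inj₂ y} e (step {b = inj₁ x} e' (zigzag-walk x ps z))

  zigzag-nonBacktracking : ∀ x₀ ps (z : Zigzag x₀ ps) → Linked _≢_ (x₀ ∷ map proj₂ ps) →
                           Linked _≢_ (map proj₁ ps) → NonBacktracking (zigzag-walk x₀ ps z)
  zigzag-nonBacktracking x₀ []             _ _        _ = tt
  zigzag-nonBacktracking x₀ ((y , x) ∷ []) _ (d ∷ _) _ = (λ { refl → d refl }) , tt
  zigzag-nonBacktracking x₀ ((y , x) ∷ (y' , x') ∷ ps) (_ , _ , z) (d ∷ ds) (d' ∷ ds') =
    (λ { refl → d refl }) , (λ { refl → d' refl }) , zigzag-nonBacktracking x ((y' , x') ∷ ps) z ds ds'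

  endpoint-∈ : ∀ x₀ ps → 1 ≤ length ps → endpoint x₀ ps ∈ map proj₂ ps
  endpoint-∈ x₀ ((y , x) ∷ [])     _ = here refl
  endpoint-∈ x₀ ((y , x) ∷ p ∷ ps) _ = there (endpoint-∈ x (p ∷ ps) (s≤s z≤n))

  closing-distinct : ∀ x₀ ps → Unique (map proj₂ ps) → 2 ≤ length ps → Linked _≢_ (endpoint x₀ ps ∷ map proj₂ ps)
  closing-distinct x₀ (_ ∷ [])           _ (s≤s ())
  closing-distinct x₀ ((y , x) ∷ p ∷ ps) (x∉ ∷ distinct) _ =
    (λ eq → AllP.All¬⇒¬Any x∉ (subst (_∈ _) eq (endpoint-∈ x (p ∷ ps) (s≤s z≤n))))
    ∷ LinkedP.AllPairs⇒Linked (x∉ ∷ distinct)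

  closedZigzag⇒cycle : ∀ x₀ ps → Zigzag x₀ ps → endpoint x₀ ps ≡ x₀ → Unique (map proj₂ ps) → 2 ≤ length ps →
                       Linked _≢_ (map proj₁ ps) → Cycle (graph B)
  closedZigzag⇒cycle x₀ ps z closes distinct long rights =
    circuit⇒cycle (zigzag-walk x₀ ps z) (cong inj₁ (sym closes)) (zigzag-nonEmpty ps z long)
      (zigzag-nonBacktracking x₀ ps z (subst (λ t → Linked _≢_ (t ∷ map proj₂ ps)) closes
                                             (closing-distinct x₀ ps distinct long)) rights)
    where
    zigzag-nonEmpty : ∀ ps (z : Zigzag x₀ ps) → 2 ≤ length ps → NonEmpty (zigzag-walk x₀ ps z)
    zigzag-nonEmpty (_ ∷ _) _ _ = tt

  lefts rights : List (W ⊎ W) → List W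
  lefts []            = []
  lefts (inj₁ x ∷ vs) = x ∷ lefts vs
  lefts (inj₂ _ ∷ vs) = lefts vs
  rights []            = []
  rights (inj₁ _ ∷ vs) = rights vs
  rights (inj₂ y ∷ vs) = y ∷ rights vs

  lefts-All : ∀ {x} vs → All (inj₁ x ≢_) vs → All (x ≢_) (lefts vs)
  lefts-All []            []       = []
  lefts-All (inj₁ _ ∷ vs) (d ∷ ds) = (λ eq → d (cong inj₁ eq)) ∷ lefts-All vs ds
  lefts-All (inj₂ _ ∷ vs) (_ ∷ ds) = lefts-All vs ds

  rights-All : ∀ {y} vs → All (inj₂ y ≢_) vs → All (y ≢_) (rights vs)
  rights-All []            []       = []
  rights-All (inj₁ _ ∷ vs) (_ ∷ ds) = rights-All vs ds
  rights-All (inj₂ _ ∷ vs) (d ∷ ds) = (λ eq → d (cong inj₂ eq)) ∷ rights-All vs ds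

  lefts-unique : ∀ vs → Unique vs → Unique (lefts vs)
  lefts-unique []            _        = []
  lefts-unique (inj₁ _ ∷ vs) (d ∷ ds) = lefts-All vs d ∷ lefts-unique vs ds
  lefts-unique (inj₂ _ ∷ vs) (_ ∷ ds) = lefts-unique vs ds

  rights-unique : ∀ vs → Unique vs → Unique (rights vs)
  rights-unique []            _        = []
  rights-unique (inj₁ _ ∷ vs) (_ ∷ ds) = rights-unique vs ds
  rights-unique (inj₂ _ ∷ vs) (d ∷ ds) = rights-All vs d ∷ rights-unique vs ds

  record ClosedZigzag : Set where
    field
      start          : W
      steps          : List (W × W)
      zigzag         : Zigzag start steps
      closes         : endpoint start steps ≡ start
      lefts-distinct  : Unique (map proj₂ steps)
      rights-distinct : Unique (map proj₁ steps)
      long           : 2 ≤ length steps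

  record ZigzagReading (x₀ x : W) (vs : List (W ⊎ W)) : Set where
    field
      steps      : List (W × W)
      zigzag     : Zigzag x steps
      closes     : endpoint x steps ≡ x₀
      lefts-eq   : map proj₂ steps ≡ lefts vs ++ x₀ ∷ []
      rights-eq  : map proj₁ steps ≡ rights vs
      nonEmpty   : 1 ≤ length steps
      long       : 2 ≤ length vs → 2 ≤ length steps

  read-zigzag : ∀ x₀ x vs → Linked (BiAdj B) (inj₁ x ∷ vs ++ inj₁ x₀ ∷ []) → ZigzagReading x₀ x vs
  read-zigzag x₀ x []                     (() ∷ _)
  read-zigzag x₀ x (inj₁ _ ∷ _)           (() ∷ _)
  read-zigzag x₀ x (inj₂ _ ∷ inj₂ _ ∷ _)  (_ ∷ () ∷ _)
  read-zigzag x₀ x (inj₂ y ∷ [])          (e ∷ e' ∷ [-]) = record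
    { steps = (y , x₀) ∷ [] ; zigzag = e , e' , tt ; closes = refl ; lefts-eq = refl ; rights-eq = refl
    ; nonEmpty = s≤s z≤n ; long = λ { (s≤s ()) } }
  read-zigzag x₀ x (inj₂ y ∷ inj₁ x' ∷ vs) (e ∷ e' ∷ path) = record
    { steps = (y , x') ∷ steps ; zigzag = e , e' , zigzag ; closes = closes
    ; lefts-eq = cong (x' ∷_) lefts-eq ; rights-eq = cong (y ∷_) rights-eq
    ; nonEmpty = s≤s z≤n ; long = λ _ → s≤s nonEmpty }
    where open ZigzagReading (read-zigzag x₀ x' vs path)

  cycle-from-left : ∀ x₀ vs → Unique (inj₁ x₀ ∷ vs) → Linked (BiAdj B) (inj₁ x₀ ∷ vs ++ inj₁ x₀ ∷ []) →
                    3 ≤ suc (length vs) → ClosedZigzag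
  cycle-from-left x₀ vs distinct closed 3≤ = record
    { start = x₀ ; steps = steps ; zigzag = zigzag ; closes = closes
    ; lefts-distinct  = subst Unique (sym lefts-eq) (rotate-unique (lefts-unique (inj₁ x₀ ∷ vs) distinct))
    ; rights-distinct = subst Unique (sym rights-eq) (rights-unique vs (AllPairs.tail distinct))
    ; long = long (ℕP.≤-pred 3≤) }
    where open ZigzagReading (read-zigzag x₀ x₀ vs closed)

  cycle⇒closedZigzag : Cycle (graph B) → ClosedZigzag
  cycle⇒closedZigzag ([] , () , _)
  cycle⇒closedZigzag (inj₁ x₀ ∷ vs , 3≤ , distinct , closed) = cycle-from-left x₀ vs distinct closed 3≤
  cycle⇒closedZigzag (inj₂ y ∷ inj₁ x₀ ∷ vs , 3≤ , distinct , e ∷ closed) =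
    cycle-from-left x₀ (vs ++ inj₂ y ∷ []) (rotate-unique distinct) (snoc-linked (inj₁ x₀ ∷ vs) closed e)
      (subst (λ n → 3 ≤ suc n) (sym (trans (LP.length-++ vs) (ℕP.+-comm (length vs) 1))) 3≤)
  cycle⇒closedZigzag (inj₂ _ ∷ inj₂ _ ∷ _ , _ , _ , () ∷ _)
  cycle⇒closedZigzag (inj₂ _ ∷ [] , s≤s () , _)

module RunCompression {A K : Set} (key : A → K) (_≟_ : DecidableEquality K) where

  compress : List A → List A
  compress = derun (λ a b → key a ≟ key b)

  compress-AllPairs : ∀ {R : A → A → Set} as → AllPairs R as → AllPairs R (compress as)
  compress-AllPairs []           []       = []
  compress-AllPairs (a ∷ [])     r        = r
  compress-AllPairs (a ∷ b ∷ as) (r ∷ rs) with key a ≟ key b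
  ... | yes _ = compress-AllPairs (b ∷ as) rs
  ... | no _  = AllP.derun⁺ _ r ∷ compress-AllPairs (b ∷ as) rs

  compress-head : ∀ a as → Σ A λ b → Σ (List A) λ bs → compress (a ∷ as) ≡ b ∷ bs × key b ≡ key a
  compress-head a []       = a , [] , refl , refl
  compress-head a (b ∷ as) with key a ≟ key b
  ... | yes a~b = let (c , cs , eq , c~b) = compress-head b as in c , cs , eq , trans c~b (sym a~b)
  ... | no _    = a , _ , refl , refl

  compress-keys : ∀ as → Linked (λ a b → key a ≢ key b) (compress as)
  compress-keys []           = []
  compress-keys (a ∷ [])     = [-]
  compress-keys (a ∷ b ∷ as) with key a ≟ key b | compress-keys (b ∷ as)
  ... | yes _   | linked = linked
  ... | no a≁b  | linked with compress-head b as
  ...   | c , cs , eq , c~b rewrite eq = (λ a~c → a≁b (trans a~c c~b)) ∷ linked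

  compress-dichotomy : ∀ a as → All (λ b → key b ≡ key a) as ⊎ 2 ≤ length (compress (a ∷ as))
  compress-dichotomy a []       = inj₁ []
  compress-dichotomy a (b ∷ as) with key a ≟ key b | compress-dichotomy b as
  ... | yes a~b | inj₁ same = inj₁ (sym a~b ∷ All.map (λ c~b → trans c~b (sym a~b)) same)
  ... | yes _   | inj₂ long = inj₂ long
  ... | no _    | _ with compress-head b as
  ...   | c , cs , eq , _ rewrite eq = inj₂ (s≤s (s≤s z≤n))

-- H fibres over B: the left vertices agree, and every right vertex y of H splits as join (key y) (sub y)
-- with key y a right vertex c of B and sub y a right vertex of the fibre over c, a bipartite graph
-- whose left vertices are the B-neighbours of c and whose edges are those of H lying over c.
record Fibration {W : Set} (H B : Bipartite W) : Set₁ where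
  field
    fibre     : W → Bipartite W
    key sub   : W → W
    join      : W → W → W
    left-down : ∀ {x} → Left H x → Left B x
    left-up   : ∀ {x} → Left B x → Left H x
    key-right : ∀ {y} → Right H y → Right B (key y)
    sub-right : ∀ {y} → Right H y → Right (fibre (key y)) (sub y)
    join-split : ∀ {y} → Right H y → join (key y) (sub y) ≡ y
    join-right : ∀ {c b} → Right B c → Right (fibre c) b → Right H (join c b)
    key-join   : ∀ {c b} → Right B c → Right (fibre c) b → key (join c b) ≡ c
    join-injective : ∀ {c b b'} → join c b ≡ join c b' → b ≡ b'
    edge-down : ∀ {x y} → Edge H x y → Edge (fibre (key y)) x (sub y)
    edge-up   : ∀ {c x b} → Right B c → Edge (fibre c) x b → Edge H x (join c b)
    base-edge⇒fibre-left : ∀ {x c} → Edge B x c → Left (fibre c) x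
    fibre-left⇒base-edge : ∀ {x c} → Right B c → Left (fibre c) x → Edge B x c
    fibre-inhabited : ∀ {c} → Right B c → Σ W (Right (fibre c))

module FibrationLemmas {W : Set} (_≟_ : DecidableEquality W) {H B : Bipartite W} (F : Fibration H B) where
  open Fibration F

  private
    GH GB : Graph
    GH = graph H
    GB = graph B
    GP : W → Graph
    GP c = graph (fibre c)

  edge-project : ∀ {x y} → Edge H x y → Edge B x (key y)
  edge-project e = fibre-left⇒base-edge (key-right (edge-right H e)) (edge-left (fibre _) (edge-down e))

  project : Hom GH GB
  project = record { vmap = vmap′ ; amap = λ {a} {b} → amap′ a b }
    where
    vmap′ : W ⊎ W → W ⊎ W
    vmap′ (inj₁ x) = inj₁ x
    vmap′ (inj₂ y) = inj₂ (key y)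
    amap′ : ∀ a b → BiAdj H a b → BiAdj B (vmap′ a) (vmap′ b)
    amap′ (inj₁ _) (inj₂ _) e = edge-project e
    amap′ (inj₂ _) (inj₁ _) e = edge-project e

  project-IsV : ∀ a → IsV GH a → IsV GB (vmap project a)
  project-IsV (inj₁ _) v = left-down v
  project-IsV (inj₂ _) v = key-right v

  include : ∀ c → Right B c → Hom (GP c) GH
  include c c∈B = record { vmap = vmap′ ; amap = λ {a} {b} → amap′ a b }
    where
    vmap′ : W ⊎ W → W ⊎ W
    vmap′ (inj₁ x) = inj₁ x
    vmap′ (inj₂ b) = inj₂ (join c b)
    amap′ : ∀ a b → BiAdj (fibre c) a b → BiAdj H (vmap′ a) (vmap′ b)
    amap′ (inj₁ _) (inj₂ _) e = edge-up c∈B e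
    amap′ (inj₂ _) (inj₁ _) e = edge-up c∈B e

  include-injective : ∀ c c∈B {a b} → vmap (include c c∈B) a ≡ vmap (include c c∈B) b → a ≡ b
  include-injective c c∈B {inj₁ _} {inj₁ _} refl = refl
  include-injective c c∈B {inj₂ _} {inj₂ _} eq   = cong inj₂ (join-injective (⊎P.inj₂-injective eq))

  connected-project : Connected GH → Connected GB
  connected-project = connected-onto project onto
    where
    onto : Onto project
    onto (inj₁ x) v = inj₁ x , left-up v , refl
    onto (inj₂ c) v with fibre-inhabited v
    ... | b , b∈P = inj₂ (join c b) , join-right v b∈P , cong inj₂ (key-join v b∈P)

  module _ (fibres-connected : ∀ c → Right B c → Connected (GP c)) where

    InFibre : W → W ⊎ W → Set
    InFibre c h = Σ (Right B c) λ c∈B → Σ (W ⊎ W) λ v → IsV (GP c) v × vmap (include c c∈B) v ≡ h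

    fibre-walk : ∀ {c h h'} → InFibre c h → InFibre c h' → Walk GH h h'
    fibre-walk (c∈B , v , v∈P , refl) (_ , v' , v'∈P , refl) = mapWalk (include _ c∈B) (fibres-connected _ c∈B v v' v∈P v'∈P)

    left-InFibre : ∀ {c x} → Edge B x c → InFibre c (inj₁ x)
    left-InFibre e = edge-right B e , inj₁ _ , base-edge⇒fibre-left e , refl

    right-InFibre : ∀ {y} → Right H y → InFibre (key y) (inj₂ y)
    right-InFibre y∈H = key-right y∈H , inj₂ _ , sub-right y∈H , cong inj₂ (join-split y∈H)

    -- A walk in B lifts to a walk in H between any two vertices over its ends: consecutive
    -- vertices of the lift are joined inside the fibre over the right vertex they share.
    lift : ∀ {s t} → Walk GB s t → ∀ h h' → IsV GH h → IsV GH h' →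
           vmap project h ≡ s → vmap project h' ≡ t → Walk GH h h'
    lift here (inj₁ x) (inj₁ _) _ _ refl refl = here
    lift here (inj₂ y) (inj₂ y') y∈H y'∈H refl eq =
      fibre-walk (right-InFibre y∈H) (subst (λ c → InFibre c (inj₂ y')) (⊎P.inj₂-injective eq) (right-InFibre y'∈H))
    lift here (inj₁ _) (inj₂ _) _ _ refl ()
    lift here (inj₂ _) (inj₁ _) _ _ refl ()
    lift (step {b = inj₂ c} e w) (inj₁ x) h' _ h'∈H refl eq' with fibre-inhabited (edge-right B e)
    ... | b , b∈P =
      fibre-walk (left-InFibre e) (edge-right B e , inj₂ b , b∈P , refl) ++ʷ
      lift w (inj₂ (join c b)) h' (join-right (edge-right B e) b∈P) h'∈H (cong inj₂ (key-join (edge-right B e) b∈P)) eq'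
    lift (step {b = inj₁ x} e w) (inj₂ y) h' y∈H h'∈H refl eq' =
      fibre-walk (right-InFibre y∈H) (left-InFibre e) ++ʷ lift w (inj₁ x) h' (left-up (edge-left B e)) h'∈H refl eq'
    lift (step {b = inj₁ _} () _) (inj₁ _) _ _ _ refl _
    lift (step {b = inj₂ _} () _) (inj₂ _) _ _ _ refl _

    connected-glue : Connected GB → Connected GH
    connected-glue conn h h' h∈H h'∈H =
      lift (conn _ _ (project-IsV h h∈H) (project-IsV h' h'∈H)) h h' h∈H h'∈H refl refl

  module ZH = Zigzags _≟_ H
  module ZB = Zigzags _≟_ B
  module ZP (c : W) = Zigzags _≟_ (fibre c)

  mapRights : (W → W) → List (W × W) → List (W × W)
  mapRights g = map (λ p → g (proj₁ p) , proj₂ p)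

  mapRights-lefts : ∀ g ps → map proj₂ (mapRights g ps) ≡ map proj₂ ps
  mapRights-lefts g ps = sym (LP.map-∘ ps)

  project-zigzag : ∀ x₀ ps → ZH.Zigzag x₀ ps → ZB.Zigzag x₀ (mapRights key ps)
  project-zigzag x₀ []             _            = tt
  project-zigzag x₀ ((y , x) ∷ ps) (e , e' , z) = edge-project e , edge-project e' , project-zigzag x ps z

  project-endpoint : ∀ x₀ ps → ZB.endpoint x₀ (mapRights key ps) ≡ ZH.endpoint x₀ ps
  project-endpoint x₀ []             = refl
  project-endpoint x₀ ((y , x) ∷ ps) = project-endpoint x ps

  open RunCompression {A = W × W} proj₁ _≟_

  -- In B, a run x₀ c x₁ c x₂ … c x_j of a zigzag may be shortened to x₀ c x_j.
  compress-zigzag : ∀ x₀ q qs → ZB.Zigzag x₀ (q ∷ qs) → ZB.Zigzag x₀ (compress (q ∷ qs))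
  compress-zigzag x₀ q       []                z            = z
  compress-zigzag x₀ (c , x) ((c' , x') ∷ qs) (e , e' , z) with c ≟ c'
  ... | yes refl = compress-zigzag x₀ (c , x') qs (e , proj₂ z)
  ... | no _     = e , e' , compress-zigzag x (c' , x') qs z

  compress-endpoint : ∀ x₀ q qs → ZB.endpoint x₀ (compress (q ∷ qs)) ≡ ZB.endpoint x₀ (q ∷ qs)
  compress-endpoint x₀ q       []                = refl
  compress-endpoint x₀ (c , x) ((c' , x') ∷ qs) with c ≟ c'
  ... | yes _ = compress-endpoint x₀ (c' , x') qs
  ... | no _  = compress-endpoint x (c' , x') qs

  -- A closed zigzag of H visiting at least two fibres projects, after merging runs within a fibre,
  -- to a closed zigzag of B that yields a cycle of B.
  projected-cycle : ∀ x₀ y₁ x₁ ps → ZH.Zigzag x₀ ((y₁ , x₁) ∷ ps) → ZH.endpoint x₀ ((y₁ , x₁) ∷ ps) ≡ x₀ →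
                    Unique (x₁ ∷ map proj₂ ps) → 2 ≤ length (compress ((key y₁ , x₁) ∷ mapRights key ps)) → Cycle GB
  projected-cycle x₀ y₁ x₁ ps z closes lefts-distinct long′ =
    ZB.closedZigzag⇒cycle x₀ _ (compress-zigzag x₀ (key y₁ , x₁) (mapRights key ps) (project-zigzag x₀ steps z))
      (trans (compress-endpoint x₀ (key y₁ , x₁) (mapRights key ps)) (trans (project-endpoint x₀ steps) closes))
      (AllPairsP.map⁺ (compress-AllPairs (mapRights key steps)
        (AllPairsP.map⁻ (subst Unique (sym (mapRights-lefts key steps)) lefts-distinct))))
      long′
      (LinkedP.map⁺ (compress-keys (mapRights key steps)))
    where
    steps = (y₁ , x₁) ∷ ps

  module _ (c : W) where

    StepOver : W × W → Set
    StepOver p = key (proj₁ p) ≡ c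

    fibre-zigzag : ∀ x₀ ps → ZH.Zigzag x₀ ps → All StepOver ps → ZP.Zigzag c x₀ (mapRights sub ps)
    fibre-zigzag x₀ []             _            _        = tt
    fibre-zigzag x₀ ((y , x) ∷ ps) (e , e' , z) (k ∷ ks) =
      subst (λ c → Edge (fibre c) x₀ (sub y)) k (edge-down e) ,
      subst (λ c → Edge (fibre c) x (sub y)) k (edge-down e') , fibre-zigzag x ps z ks

    fibre-endpoint : ∀ x₀ ps → ZP.endpoint c x₀ (mapRights sub ps) ≡ ZH.endpoint x₀ ps
    fibre-endpoint x₀ []             = refl
    fibre-endpoint x₀ ((y , x) ∷ ps) = fibre-endpoint x ps

    sub-distinct : ∀ {x x' y y'} → Edge H x y → Edge H x' y' → key y ≡ c → key y' ≡ c → y ≢ y' → sub y ≢ sub y'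
    sub-distinct e e' k k' y≢y' eq =
      y≢y' (trans (sym (join-split (edge-right H e))) (trans (cong₂ join (trans k (sym k')) eq) (join-split (edge-right H e'))))

    fibre-rights : ∀ x₀ ps → ZH.Zigzag x₀ ps → All StepOver ps → Linked _≢_ (map proj₁ ps) →
                   Linked _≢_ (map proj₁ (mapRights sub ps))
    fibre-rights x₀ []                         _                _             _        = []
    fibre-rights x₀ (_ ∷ [])                   _                _             _        = [-]
    fibre-rights x₀ ((y , x) ∷ (y' , x') ∷ ps) (e , _ , e' , z) (k ∷ k' ∷ ks) (d ∷ ds) =
      sub-distinct e e' k k' d ∷ fibre-rights x ((y' , x') ∷ ps) (e' , z) (k' ∷ ks) ds

    fibre-cycle : (Z : ZH.ClosedZigzag) → let open ZH.ClosedZigzag Z in All StepOver steps → Cycle (GP c)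
    fibre-cycle Z over =
      ZP.closedZigzag⇒cycle c start (mapRights sub steps) (fibre-zigzag start steps zigzag over)
        (trans (fibre-endpoint start steps) closes)
        (subst Unique (sym (mapRights-lefts sub steps)) lefts-distinct)
        (subst (2 ≤_) (sym (LP.length-map _ steps)) long)
        (fibre-rights start steps zigzag over (LinkedP.AllPairs⇒Linked rights-distinct))
      where open ZH.ClosedZigzag Z

  acyclic-glue : Acyclic GB → (∀ c → Right B c → Acyclic (GP c)) → Acyclic GH
  acyclic-glue base-acyclic fibres-acyclic cyc with ZH.cycle⇒closedZigzag cyc
  ... | Z@record { start = x₀ ; steps = (y₁ , x₁) ∷ ps ; zigzag = z@(e₁ , _) ; closes = closes
                 ; lefts-distinct = lefts-distinct }
    with compress-dichotomy (key y₁ , x₁) (mapRights key ps)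
  ...   | inj₂ long′ = base-acyclic (projected-cycle x₀ y₁ x₁ ps z closes lefts-distinct long′)
  ...   | inj₁ same  = fibres-acyclic (key y₁) (key-right (edge-right H e₁)) (fibre-cycle (key y₁) Z (refl ∷ AllP.map⁻ same))

  module _ (fibres-connected : ∀ c → Right B c → Connected (GP c)) where

    RightOver : W → W ⊎ W → Set
    RightOver c v = Σ W λ y → v ≡ inj₂ y × key y ≡ c

    over-distinct : ∀ {c c' v v'} → RightOver c v → RightOver c' v' → c ≢ c' → v ≢ v'
    over-distinct (_ , refl , k) (_ , refl , k') c≢c' refl = c≢c' (trans (sym k) k')

    include-over : ∀ {c x} (c∈B : Right B c) v → BiAdj (fibre c) (inj₁ x) v → RightOver c (vmap (include c c∈B) v)
    include-over c∈B (inj₂ b) e = _ , refl , key-join c∈B (edge-right (fibre _) e)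

    fibre-path : ∀ {x x' c} → Edge B x c → Edge B x' c → x ≢ x' →
                 Σ (Walk GH (inj₁ x) (inj₁ x')) λ w → NonEmpty w × NonBacktracking w × RightOver c (second w) × RightOver c (penultimate w)
    fibre-path {x} {x'} {c} e e' x≢x' =
      mapWalk ι w , mapWalk-nonEmpty ι w w≠ , mapWalk-nonBacktracking ι (include-injective c c∈B) w w-nb ,
      subst (RightOver c) (sym (mapWalk-second ι w)) (include-over c∈B (second w) (second-adj w w≠)) ,
      subst (RightOver c) (sym (mapWalk-penultimate ι w))
            (include-over c∈B (penultimate w) (biAdj-sym (fibre c) {penultimate w} {inj₁ x'} (penultimate-adj w w≠)))
      where
      c∈B = edge-right B e
      ι = include c c∈B
      open BipartiteWalks _≟_ (fibre c) using (reduce)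
      reduced = reduce (fibres-connected c c∈B (inj₁ x) (inj₁ x') (base-edge⇒fibre-left e) (base-edge⇒fibre-left e'))
      w = proj₁ reduced
      w-nb = proj₂ reduced
      w≠ = nonEmpty-distinct w (λ eq → x≢x' (⊎P.inj₁-injective eq))

    -- A zigzag of B with distinct consecutive vertices lifts to a non-backtracking walk of H:
    -- consecutive fibre paths lie over different right vertices, so the junctions do not turn back.
    lift-zigzag : ∀ x₀ c x ps → ZB.Zigzag x₀ ((c , x) ∷ ps) → Linked _≢_ (x₀ ∷ x ∷ map proj₂ ps) → Linked _≢_ (c ∷ map proj₁ ps) →
                  Σ (Walk GH (inj₁ x₀) (inj₁ (ZB.endpoint x ps))) λ w → NonEmpty w × NonBacktracking w × RightOver c (second w)
    lift-zigzag x₀ c x [] (e , e' , _) (d ∷ _) _ with fibre-path e e' d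
    ... | w , w≠ , w-nb , first , _ = w , w≠ , w-nb , first
    lift-zigzag x₀ c x ((c' , x') ∷ ps) (e , e' , z) (d ∷ ds) (d' ∷ ds')
      with fibre-path e e' d | lift-zigzag x c' x' ps z ds ds'
    ... | w , w≠ , w-nb , first , last | w' , _ , w'-nb , first' =
      w ++ʷ w' , ++ʷ-nonEmpty w w' w≠ , ++ʷ-nonBacktracking w w' w-nb w'-nb (λ _ _ → over-distinct last first' d') ,
      subst (RightOver c) (sym (++ʷ-second w w' w≠)) first

    acyclic-project : Acyclic GH → Acyclic GB
    acyclic-project acyclic cyc with ZB.cycle⇒closedZigzag cyc
    ... | record { start = x₀ ; steps = (c₁ , x₁) ∷ ps ; zigzag = z ; closes = closes
                 ; lefts-distinct = lefts-distinct ; rights-distinct = rights-distinct ; long = long }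
      with lift-zigzag x₀ c₁ x₁ ps z
             (subst (λ t → Linked _≢_ (t ∷ x₁ ∷ map proj₂ ps)) closes (ZB.closing-distinct x₀ ((c₁ , x₁) ∷ ps) lefts-distinct long))
             (LinkedP.AllPairs⇒Linked rights-distinct)
    ... | w , w≠ , w-nb , _ = acyclic (circuit⇒cycle w (cong inj₁ (sym closes)) w≠ w-nb)
      where
      open BipartiteWalks _≟_ H using (circuit⇒cycle)

  tree-glue : IsTree GB → (∀ c → Right B c → IsTree (GP c)) → IsTree GH
  tree-glue (conn , acyclic) fibres-tree =
    connected-glue (λ c c∈B → proj₁ (fibres-tree c c∈B)) conn ,
    acyclic-glue acyclic (λ c c∈B → proj₂ (fibres-tree c c∈B))

  tree-project : IsTree GH → (∀ c → Right B c → Connected (GP c)) → IsTree GB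
  tree-project (conn , acyclic) fibres-connected = connected-project conn , acyclic-project fibres-connected acyclic

module _ {A : Set} where

  take-length : ∀ q (y : List A) → length y ≡ suc q → length (take q y) ≡ q
  take-length q y ∣y∣ = trans (LP.length-take q y) (ℕP.m≤n⇒m⊓n≡m (subst (q ≤_) (sym ∣y∣) (ℕP.n≤1+n q)))

  drop-length : ∀ q (y : List A) → length y ≡ suc q → length (drop q y) ≡ 1
  drop-length q y ∣y∣ = trans (LP.length-drop q y) (trans (cong (_∸ q) ∣y∣) (ℕP.m+n∸n≡m 1 q))

  take-prefix : ∀ (c b : List A) → take (length c) (c ++ b) ≡ c
  take-prefix []      b = refl
  take-prefix (a ∷ c) b = cong (a ∷_) (take-prefix c b)

-- Extension graphs with left words of length p and right words of length q:
-- E X n w is ext X n n w, and the general case is the stepping stone of the induction.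
module _ {k : ℕ} (X : Shift k) where

  ext : ℕ → ℕ → Word k → Bipartite (Word k)
  ext p q w = record
    { Left  = λ u → length u ≡ p × InL X (u ++ w)
    ; Right = λ v → length v ≡ q × InL X (w ++ v)
    ; Edge  = λ u v → length u ≡ p × length v ≡ q × InL X (u ++ w ++ v)
    ; edge-left  = λ { {u} {v} (∣u∣ , _ , uwv) → ∣u∣ , InL-prefix X (u ++ w) v (InL-unassoc X u w v uwv) }
    ; edge-right = λ { {u} {v} (_ , ∣v∣ , uwv) → ∣v∣ , InL-suffix X u (w ++ v) uwv } }

  E≅ext : ∀ n w → E X n w ≅ graph (ext n n w)
  E≅ext n w = record { to = identity₁ ; from = identity₂ ; from∘to = λ _ → refl ; to∘from = λ _ → refl
                     ; to-IsV = λ {a} → same-IsV₁ a ; from-IsV = λ {a} → same-IsV₂ a }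
    where
    identity₁ : Hom (E X n w) (graph (ext n n w))
    identity₁ = record { vmap = λ a → a ; amap = λ {a} {b} → adj a b }
      where
      adj : ∀ a b → Adj (E X n w) a b → BiAdj (ext n n w) a b
      adj (inj₁ _) (inj₂ _) e = e
      adj (inj₂ _) (inj₁ _) e = e
    identity₂ : Hom (graph (ext n n w)) (E X n w)
    identity₂ = record { vmap = λ a → a ; amap = λ {a} {b} → adj a b }
      where
      adj : ∀ a b → BiAdj (ext n n w) a b → Adj (E X n w) a b
      adj (inj₁ _) (inj₂ _) e = e
      adj (inj₂ _) (inj₁ _) e = e
    same-IsV₁ : ∀ a → IsV (E X n w) a → IsV (graph (ext n n w)) a
    same-IsV₁ (inj₁ _) v = v
    same-IsV₁ (inj₂ _) v = v
    same-IsV₂ : ∀ a → IsV (graph (ext n n w)) a → IsV (E X n w) a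
    same-IsV₂ (inj₁ _) v = v
    same-IsV₂ (inj₂ _) v = v

  -- Right words of length q + 1 split as y = c b, with c of length q (a right word of
  -- ext p q w) and b a letter (a right word of ext p 1 (w c)).
  right-fibration : ∀ p q w → Fibration (ext p (suc q) w) (ext p q w)
  right-fibration p q w = record
    { fibre = λ c → ext p 1 (w ++ c) ; key = take q ; sub = drop q ; join = _++_
    ; left-down = λ u → u ; left-up = λ u → u
    ; key-right = λ { {y} (∣y∣ , wy) → take-length q y ∣y∣ , InL-prefix X (w ++ take q y) (drop q y) (split wy) }
    ; sub-right = λ { {y} (∣y∣ , wy) → drop-length q y ∣y∣ , split wy }
    ; join-split = λ { {y} _ → LP.take++drop≡id q y }
    ; join-right = λ { {c} {b} (∣c∣ , _) (∣b∣ , wcb) → joined-length c b ∣c∣ ∣b∣ , InL-assoc X w c b wcb }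
    ; key-join = λ { {c} {b} (∣c∣ , _) _ → subst (λ n → take n (c ++ b) ≡ c) ∣c∣ (take-prefix c b) }
    ; join-injective = λ { {c} eq → LP.++-cancelˡ c _ _ eq }
    ; edge-down = λ { {u} {y} (∣u∣ , ∣y∣ , uwy) → ∣u∣ , drop-length q y ∣y∣ , subst (λ t → InL X (u ++ t)) (sym (split-eq y)) uwy }
    ; edge-up = λ { {c} {u} {b} (∣c∣ , _) (∣u∣ , ∣b∣ , uwcb) →
                    ∣u∣ , joined-length c b ∣c∣ ∣b∣ , subst (λ t → InL X (u ++ t)) (LP.++-assoc w c b) uwcb }
    ; base-edge⇒fibre-left = λ { (∣u∣ , _ , uwc) → ∣u∣ , uwc }
    ; fibre-left⇒base-edge = λ { (∣c∣ , _) (∣u∣ , uwc) → ∣u∣ , ∣c∣ , uwc }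
    ; fibre-inhabited = λ { {c} (_ , wc) → let (b , ∣b∣ , wcb) = InL-extendʳ X (w ++ c) wc 1 in b , ∣b∣ , wcb }
    }
    where
    split-eq : ∀ y → (w ++ take q y) ++ drop q y ≡ w ++ y
    split-eq y = trans (LP.++-assoc w (take q y) (drop q y)) (cong (w ++_) (LP.take++drop≡id q y))
    split : ∀ {y} → InL X (w ++ y) → InL X ((w ++ take q y) ++ drop q y)
    split {y} = subst (InL X) (sym (split-eq y))
    joined-length : ∀ (c b : Word k) → length c ≡ q → length b ≡ 1 → length (c ++ b) ≡ suc q
    joined-length c b ∣c∣ ∣b∣ = trans (LP.length-++ c) (trans (cong₂ _+_ ∣c∣ ∣b∣) (ℕP.+-comm q 1))

  -- Symmetrically, left words of length p + 1 split as a c, with a a letter; the graphs are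
  -- swapped so that the split side is again the right one.
  left-fibration : ∀ p q w → Fibration (swap (ext (suc p) q w)) (swap (ext p q w))
  left-fibration p q w = record
    { fibre = λ c → swap (ext 1 q (c ++ w)) ; key = drop 1 ; sub = take 1 ; join = λ c b → b ++ c
    ; left-down = λ v → v ; left-up = λ v → v
    ; key-right = λ { {a ∷ u} (∣au∣ , auw) → ℕP.suc-injective ∣au∣ , InL-suffix X (a ∷ []) (u ++ w) auw }
    ; sub-right = λ { {a ∷ u} (_ , auw) → refl , auw }
    ; join-split = λ { {a ∷ u} _ → refl }
    ; join-right = λ { {c} {a ∷ []} (∣c∣ , _) (_ , acw) → cong suc ∣c∣ , acw }
    ; key-join = λ { {c} {a ∷ []} _ _ → refl }
    ; join-injective = λ { {c} {b} {b'} eq → LP.++-cancelʳ c b b' eq }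
    ; edge-down = λ { {v} {a ∷ u} (_ , ∣v∣ , auwv) → refl , ∣v∣ , subst (λ t → InL X (a ∷ t)) (sym (LP.++-assoc u w v)) auwv }
    ; edge-up = λ { {c} {v} {a ∷ []} (∣c∣ , _) (_ , ∣v∣ , acwv) →
                    cong suc ∣c∣ , ∣v∣ , subst (λ t → InL X (a ∷ t)) (LP.++-assoc c w v) acwv }
    ; base-edge⇒fibre-left = λ { {v} {c} (_ , ∣v∣ , cwv) → ∣v∣ , InL-unassoc X c w v cwv }
    ; fibre-left⇒base-edge = λ { {v} {c} (∣c∣ , _) (∣v∣ , cwv) → ∣c∣ , ∣v∣ , InL-assoc X c w v cwv }
    ; fibre-inhabited = λ { {c} (_ , cw) → let (a , ∣a∣ , acw) = InL-extendˡ X (c ++ w) cw 1 in a , ∣a∣ , acw }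
    }

module _ {W : Set} (B : Bipartite W) where

  swap-tree : IsTree (graph B) → IsTree (graph (swap B))
  swap-tree = ≅-tree (swap-≅ B)

  unswap-tree : IsTree (graph (swap B)) → IsTree (graph B)
  unswap-tree = ≅-tree (swap-≅ (swap B))

  swap-connected : Connected (graph B) → Connected (graph (swap B))
  swap-connected = ≅-connected (swap-≅ B)

  unswap-connected : Connected (graph (swap B)) → Connected (graph B)
  unswap-connected = ≅-connected (swap-≅ (swap B))

descend : ∀ {P : ℕ → Set} → (∀ n → P (suc n) → P n) → ∀ n → P (suc n) → P 1
descend down zero    p = p
descend down (suc n) p = descend down n (down (suc n) p)

module _ {k : ℕ} (X : Shift k) (m : ℕ) where

  private
    _≟_ : DecidableEquality (Word k)
    _≟_ = LP.≡-dec FinP._≟_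

  Trees Connecteds : ℕ → ℕ → Set
  Trees p q      = ∀ w → m ≤ length w → InL X w → IsTree (graph (ext X p q w))
  Connecteds p q = ∀ w → m ≤ length w → InL X w → Connected (graph (ext X p q w))

  longer-right : ∀ (w c : Word k) → m ≤ length w → m ≤ length (w ++ c)
  longer-right w c ∣w∣ = ℕP.≤-trans ∣w∣ (subst (length w ≤_) (sym (LP.length-++ w)) (ℕP.m≤m+n (length w) (length c)))

  longer-left : ∀ (c w : Word k) → m ≤ length w → m ≤ length (c ++ w)
  longer-left c w ∣w∣ = ℕP.≤-trans ∣w∣ (subst (length w ≤_) (sym (LP.length-++ c)) (ℕP.m≤n+m (length w) (length c)))

  grow-right : ∀ p q → Trees p q → Trees p 1 → Trees p (suc q)
  grow-right p q trees trees₁ w ∣w∣ w∈L =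
    FibrationLemmas.tree-glue _≟_ (right-fibration X p q w) (trees w ∣w∣ w∈L)
      (λ c c∈B → trees₁ (w ++ c) (longer-right w c ∣w∣) (proj₂ c∈B))

  grow-left : ∀ p q → Trees p q → Trees 1 q → Trees (suc p) q
  grow-left p q trees trees₁ w ∣w∣ w∈L = unswap-tree (ext X (suc p) q w)
    (FibrationLemmas.tree-glue _≟_ (left-fibration X p q w) (swap-tree (ext X p q w) (trees w ∣w∣ w∈L))
      (λ c c∈B → swap-tree (ext X 1 q (c ++ w)) (trees₁ (c ++ w) (longer-left c w ∣w∣) (proj₂ c∈B))))

  shrink-right-connected : ∀ p q → Connecteds p (suc q) → Connecteds p q
  shrink-right-connected p q conn w ∣w∣ w∈L =
    FibrationLemmas.connected-project _≟_ (right-fibration X p q w) (conn w ∣w∣ w∈L)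

  shrink-left-connected : ∀ p q → Connecteds (suc p) q → Connecteds p q
  shrink-left-connected p q conn w ∣w∣ w∈L = unswap-connected (ext X p q w)
    (FibrationLemmas.connected-project _≟_ (left-fibration X p q w) (swap-connected (ext X (suc p) q w) (conn w ∣w∣ w∈L)))

  shrink-right : ∀ p q → Trees p (suc q) → Connecteds p 1 → Trees p q
  shrink-right p q trees conn₁ w ∣w∣ w∈L =
    FibrationLemmas.tree-project _≟_ (right-fibration X p q w) (trees w ∣w∣ w∈L)
      (λ c c∈B → conn₁ (w ++ c) (longer-right w c ∣w∣) (proj₂ c∈B))

  shrink-left : ∀ p q → Trees (suc p) q → Connecteds 1 q → Trees p q
  shrink-left p q trees conn₁ w ∣w∣ w∈L = unswap-tree (ext X p q w)
    (FibrationLemmas.tree-project _≟_ (left-fibration X p q w) (swap-tree (ext X (suc p) q w) (trees w ∣w∣ w∈L))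
      (λ c c∈B → swap-connected (ext X 1 q (c ++ w)) (conn₁ (c ++ w) (longer-left c w ∣w∣) (proj₂ c∈B))))

  trees-up-left : Trees 1 1 → ∀ p → Trees (suc p) 1
  trees-up-left trees zero    = trees
  trees-up-left trees (suc p) = grow-left (suc p) 1 (trees-up-left trees p) trees

  trees-up : Trees 1 1 → ∀ p q → Trees (suc p) (suc q)
  trees-up trees p zero    = trees-up-left trees p
  trees-up trees p (suc q) = grow-right (suc p) (suc q) (trees-up trees p q) (trees-up-left trees p)

  -- Conversely, if all ext X n n w are trees, so are all ext X 1 1 w: first connectivity descends
  -- to ext X n 1 and ext X 1 1, which then lets the tree property descend along the same path.
  trees-down : ∀ n → Trees (suc n) (suc n) → Trees 1 1
  trees-down n trees = descend (λ p t → shrink-left p 1 t conn₁₁) n trees-n1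
    where
    conn-nn : Connecteds (suc n) (suc n)
    conn-nn w ∣w∣ w∈L = proj₁ (trees w ∣w∣ w∈L)
    conn-n1 : Connecteds (suc n) 1
    conn-n1 = descend (shrink-right-connected (suc n)) n conn-nn
    conn₁₁ : Connecteds 1 1
    conn₁₁ = descend (λ p → shrink-left-connected p 1) n conn-n1
    trees-n1 : Trees (suc n) 1
    trees-n1 = descend (λ q t → shrink-right (suc n) q t conn-n1) n trees

  TreesE : ℕ → Set
  TreesE n = ∀ w → m ≤ length w → InL X w → IsTree (E X n w)

  dendric⇒trees : TreesE 1 → ∀ n → 1 ≤ n → TreesE n
  dendric⇒trees dendric (suc n) _ w ∣w∣ w∈L =
    ≅-tree (≅-sym (E≅ext X (suc n) w)) (trees-up (λ v ∣v∣ v∈L → ≅-tree (E≅ext X 1 v) (dendric v ∣v∣ v∈L)) n n w ∣w∣ w∈L)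

  trees⇒dendric : ∀ n → 1 ≤ n → TreesE n → TreesE 1
  trees⇒dendric (suc n) _ trees w ∣w∣ w∈L =
    ≅-tree (≅-sym (E≅ext X 1 w)) (trees-down n (λ v ∣v∣ v∈L → ≅-tree (E≅ext X (suc n) v) (trees v ∣v∣ v∈L)) w ∣w∣ w∈L)

theorem8p4 : ∀ {k : ℕ} (X : Shift k) (m : ℕ) → 1 ≤ m →
    (EventuallyDendric X m ⇔ (∀ (n : ℕ) → 1 ≤ n → ∀ (w : Word k) → m ≤ length w → InL X w → IsTree (E X n w)))
    × (EventuallyDendric X m ⇔ Σ ℕ (λ n → 1 ≤ n × (∀ (w : Word k) → m ≤ length w → InL X w → IsTree (E X n w))))
theorem8p4 X m _ =
  mk⇔ (dendric⇒trees X m) (λ trees → trees 1 ℕP.≤-refl) ,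
  mk⇔ (λ dendric → 1 , ℕP.≤-refl , dendric) (λ (n , 1≤n , trees) → trees⇒dendric X m n 1≤n trees)
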